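{- Let $f\colon\{0,\dots,n\}\to\mathbb{Z}$ and $g\colon\{0,\dots,m\}\to\mathbb{Z}$, with $R_\delta$, $P^\pm_\delta$ as defined in the context. For any $\delta\ge0$, $R_\delta$ consists exactly of all points $(i,j)$ that are on or below $P^+_\delta$ and on or above $P^-_\delta$.
   Context: $\breve f$ is the pointwise maximal convex function $\{0,\dots,n\}\to\mathbb{Q}$ with $\breve f\le f$, similarly $\breve g$; $\breve h(k)=\min\{\breve f(i)+\breve g(j):i+j=k,\ 0\le i\le n,\ 0\le j\le m\}$. A point is a pair $(i,j)\in\{0,\dots,n\}\times\{0,\dots,m\}$, lying on diagonal $i+j$. For $\delta\ge0$, $(i,j)$ is $\delta$-relevant if $\breve f(i)+\breve g(j)\le\breve h(i+j)+\delta$, and $R_\delta$ is the set of $\delta$-relevant points. $P^+_\delta$ (resp. $P^-_\delta$) is the set of points $(i,k-i)$, $k\in\{0,\dots,n+m\}$, with $i$ maximal (resp. minimal) such that $(i,k-i)$ is $\delta$-relevant. A monotone path is a set $P$ of points containing exactly one point $(i_k,j_k)$ on each diagonal $k\in\{0,\dots,n+m\}$ with $(i_{k+1},j_{k+1})\in\{(i_k+1,j_k),(i_k,j_k+1)\}$; $P^\pm_\delta$ are monotone paths. For a point $(i,j)$ and monotone path $P$, let $(a,b)\in P$ be the point with $a+b=i+j$; $(i,j)$ is below $P$ if $i<a$, above $P$ if $i>a$, and on $P$ if $i=a$. -}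

module Defs where

open import Data.Nat as ℕ using (ℕ; _∸_)
open import Data.Integer as ℤ using (ℤ; +_)
open import Data.Rational using (ℚ; _/_; _+_; _*_; _≤_)
open import Data.Product using (Σ; _×_; ∃-syntax)
open import Relation.Binary.PropositionalEquality using (_≡_)

ℕ→ℚ : ℕ → ℚ
ℕ→ℚ k = (+ k) / 1

ℤ→ℚ : ℤ → ℚ
ℤ→ℚ z = z / 1

ConvexOn : ℕ → (ℕ → ℚ) → Set
ConvexOn n F = ∀ a b c → a ℕ.< b → b ℕ.< c → c ℕ.≤ n →
  ℕ→ℚ (c ∸ a) * F b ≤ ℕ→ℚ (c ∸ b) * F a + ℕ→ℚ (b ∸ a) * F c

-- F is the pointwise maximal convex function on {0,…,n} below f
-- (the lower convex envelope  f̆ ); values of F outside {0,…,n} are irrelevant.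
IsConvexEnvelope : ℕ → (ℕ → ℤ) → (ℕ → ℚ) → Set
IsConvexEnvelope n f F =
  ConvexOn n F ×
  (∀ i → i ℕ.≤ n → F i ≤ ℤ→ℚ (f i)) ×
  (∀ (G : ℕ → ℚ) → ConvexOn n G → (∀ i → i ℕ.≤ n → G i ≤ ℤ→ℚ (f i)) →
     ∀ i → i ℕ.≤ n → G i ≤ F i)

IsMinConvolution : ℕ → ℕ → (ℕ → ℚ) → (ℕ → ℚ) → (ℕ → ℚ) → Set
IsMinConvolution n m F G H = ∀ k → k ℕ.≤ n ℕ.+ m →
  (∃[ i ] ∃[ j ] (i ℕ.+ j ≡ k × i ℕ.≤ n × j ℕ.≤ m × H k ≡ F i + G j)) ×
  (∀ i j → i ℕ.+ j ≡ k → i ℕ.≤ n → j ℕ.≤ m → H k ≤ F i + G j)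

Relevant : ℕ → ℕ → (ℕ → ℚ) → (ℕ → ℚ) → (ℕ → ℚ) → ℚ → ℕ → ℕ → Set
Relevant n m F G H δ i j = i ℕ.≤ n × j ℕ.≤ m × F i + G j ≤ H (i ℕ.+ j) + δ

-- a is the maximal i such that (i , k - i) is δ-relevant, i.e. (a , k - a) ∈ P⁺_δ
IsPplus : ℕ → ℕ → (ℕ → ℚ) → (ℕ → ℚ) → (ℕ → ℚ) → ℚ → ℕ → ℕ → Set
IsPplus n m F G H δ k a = a ℕ.≤ k × Relevant n m F G H δ a (k ∸ a) ×
  (∀ i → i ℕ.≤ k → Relevant n m F G H δ i (k ∸ i) → i ℕ.≤ a)

-- a is the minimal i such that (i , k - i) is δ-relevant, i.e. (a , k - a) ∈ P⁻_δ
IsPminus : ℕ → ℕ → (ℕ → ℚ) → (ℕ → ℚ) → (ℕ → ℚ) → ℚ → ℕ → ℕ → Set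
IsPminus n m F G H δ k a = a ℕ.≤ k × Relevant n m F G H δ a (k ∸ a) ×
  (∀ i → i ℕ.≤ k → Relevant n m F G H δ i (k ∸ i) → a ℕ.≤ i)

{-# OPTIONS --safe #-}
-- Along the diagonal i + j = k the map i ↦ F i + G (k ∸ i) is convex, being a sum of
-- a convex function and a reflected convex function; hence each of its sublevel sets,
-- in particular the δ-relevant points of the diagonal, is an interval, whose ends are
-- the points of P⁻_δ and P⁺_δ. Concretely, for b < i < a the convexity inequalities
-- of F at (b, i, a) and of G at (k ∸ a, k ∸ i, k ∸ b) carry the same weights a ∸ i
-- and i ∸ b, so adding them bounds F i + G (k ∸ i) by a convex combination of the
-- values at the two ends.
module Submission where

open import Defs
open import Data.Nat using (ℕ; _≤_; _+_; _<_; _∸_; NonZero; >-nonZero)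
open import Data.Integer using (ℤ)
open import Data.Rational using (ℚ; 0ℚ; mkℚ; Positive; NonNegative)
  renaming (_≤_ to _≤ℚ_; _+_ to _+ℚ_; _*_ to _*ℚ_)
open import Data.Product using (_×_; _,_; proj₁; proj₂)
open import Function.Bundles using (_⇔_; mk⇔)

open import Data.Nat.Properties
  using (≤-trans; <⇒≤; m<n⇒0<n∸m; ∸-monoʳ-<; m∸n+n≡m; +-∸-assoc; m+n∸m≡n; m+[n∸m]≡n;
         m≤m+n; m≤n⇒m<n∨m≡n)
import Data.Integer as ℤ
open import Data.Integer.Properties using (*-identityʳ)
import Data.Rational.Properties as ℚ
open import Data.Rational.Solver using (module +-*-Solver)
open import Data.Nat.Coprimality using (1-coprimeTo; sym)
open import Data.Sum using (inj₁; inj₂)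
open import Relation.Binary.PropositionalEquality
  using (_≡_; refl; cong; cong₂; subst; trans; module ≡-Reasoning)
  renaming (sym to ≡-sym)

∸-split : ∀ {y x k} → y ≤ x → x ≤ k → k ∸ y ≡ (k ∸ x) + (x ∸ y)
∸-split {y} {x} {k} y≤x x≤k = begin
  k ∸ y             ≡⟨ cong (_∸ y) (≡-sym (m∸n+n≡m x≤k)) ⟩
  (k ∸ x) + x ∸ y   ≡⟨ +-∸-assoc (k ∸ x) y≤x ⟩
  (k ∸ x) + (x ∸ y) ∎
  where open ≡-Reasoning

∸-∸-reflect : ∀ {y x k} → y ≤ x → x ≤ k → (k ∸ y) ∸ (k ∸ x) ≡ x ∸ y
∸-∸-reflect {y} {x} {k} y≤x x≤k =
  subst (λ t → t ∸ (k ∸ x) ≡ x ∸ y) (≡-sym (∸-split y≤x x≤k)) (m+n∸m≡n (k ∸ x) (x ∸ y))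

ℕ→ℚ≡mkℚ : ∀ k → ℕ→ℚ k ≡ mkℚ (ℤ.+ k) 0 (sym (1-coprimeTo k))
ℕ→ℚ≡mkℚ k = ℚ.normalize-coprime (sym (1-coprimeTo k))

ℕ→ℚ-+ : ∀ x y → ℕ→ℚ (x + y) ≡ ℕ→ℚ x +ℚ ℕ→ℚ y
ℕ→ℚ-+ x y = begin
  ℕ→ℚ (x + y)
    ≡⟨ ℚ./-cong (cong₂ ℤ._+_ (≡-sym (*-identityʳ (ℤ.+ x))) (≡-sym (*-identityʳ (ℤ.+ y)))) refl ⟩
  mkℚ (ℤ.+ x) 0 (sym (1-coprimeTo x)) +ℚ mkℚ (ℤ.+ y) 0 (sym (1-coprimeTo y))
    ≡⟨ cong₂ _+ℚ_ (≡-sym (ℕ→ℚ≡mkℚ x)) (≡-sym (ℕ→ℚ≡mkℚ y)) ⟩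
  ℕ→ℚ x +ℚ ℕ→ℚ y ∎
  where open ≡-Reasoning

ℕ→ℚ-nonNeg : ∀ k → NonNegative (ℕ→ℚ k)
ℕ→ℚ-nonNeg k = ℚ.normalize-nonNeg k 1

ℕ→ℚ-pos : ∀ {k} → 0 < k → Positive (ℕ→ℚ k)
ℕ→ℚ-pos {k} 0<k = ℚ.normalize-pos k 1
  where instance
  k≢0 : NonZero k
  k≢0 = >-nonZero 0<k

weighted-sum-≤ : ∀ w u v {x y x₁ x₂ y₁ y₂ T : ℚ} →
  .{{Positive w}} → .{{NonNegative u}} → .{{NonNegative v}} → w ≡ u +ℚ v →
  w *ℚ x ≤ℚ u *ℚ x₁ +ℚ v *ℚ x₂ → w *ℚ y ≤ℚ v *ℚ y₁ +ℚ u *ℚ y₂ →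
  x₁ +ℚ y₂ ≤ℚ T → x₂ +ℚ y₁ ≤ℚ T → x +ℚ y ≤ℚ T
weighted-sum-≤ w u v {x} {y} {x₁} {x₂} {y₁} {y₂} {T} w≡u+v x-bound y-bound end₁ end₂ =
  ℚ.*-cancelˡ-≤-pos w (begin
    w *ℚ (x +ℚ y)                                     ≡⟨ ℚ.*-distribˡ-+ w x y ⟩
    w *ℚ x +ℚ w *ℚ y                                  ≤⟨ ℚ.+-mono-≤ x-bound y-bound ⟩
    (u *ℚ x₁ +ℚ v *ℚ x₂) +ℚ (v *ℚ y₁ +ℚ u *ℚ y₂)      ≡⟨ regroup u v x₁ x₂ y₁ y₂ ⟩
    u *ℚ (x₁ +ℚ y₂) +ℚ v *ℚ (x₂ +ℚ y₁)                ≤⟨ ℚ.+-mono-≤ (ℚ.*-monoˡ-≤-nonNeg u end₁)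
                                                                     (ℚ.*-monoˡ-≤-nonNeg v end₂) ⟩
    u *ℚ T +ℚ v *ℚ T                                  ≡⟨ ℚ.*-distribʳ-+ T u v ⟨
    (u +ℚ v) *ℚ T                                     ≡⟨ cong (_*ℚ T) w≡u+v ⟨
    w *ℚ T                                            ∎)
  where
  open ℚ.≤-Reasoning
  open +-*-Solver
  regroup : ∀ u v x₁ x₂ y₁ y₂ →
    (u *ℚ x₁ +ℚ v *ℚ x₂) +ℚ (v *ℚ y₁ +ℚ u *ℚ y₂) ≡ u *ℚ (x₁ +ℚ y₂) +ℚ v *ℚ (x₂ +ℚ y₁)
  regroup = solve 6 (λ u v x₁ x₂ y₁ y₂ →
    (u :* x₁ :+ v :* x₂) :+ (v :* y₁ :+ u :* y₂) := u :* (x₁ :+ y₂) :+ v :* (x₂ :+ y₁)) refl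

ConvexOn-reflect : ∀ {m G} → ConvexOn m G → ∀ {k y x z} → y < x → x < z → z ≤ k → k ∸ y ≤ m →
  ℕ→ℚ (z ∸ y) *ℚ G (k ∸ x) ≤ℚ ℕ→ℚ (x ∸ y) *ℚ G (k ∸ z) +ℚ ℕ→ℚ (z ∸ x) *ℚ G (k ∸ y)
ConvexOn-reflect convex {k} {y} {x} {z} y<x x<z z≤k k∸y≤m
  rewrite ≡-sym (∸-∸-reflect (<⇒≤ (≤-trans y<x (<⇒≤ x<z))) z≤k)
        | ≡-sym (∸-∸-reflect (<⇒≤ y<x) (≤-trans (<⇒≤ x<z) z≤k))
        | ≡-sym (∸-∸-reflect (<⇒≤ x<z) z≤k)
  = convex (k ∸ z) (k ∸ x) (k ∸ y)
      (∸-monoʳ-< x<z z≤k) (∸-monoʳ-< y<x (≤-trans (<⇒≤ x<z) z≤k)) k∸y≤m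

diagonal-sublevel-convex : ∀ {n m F G} → ConvexOn n F → ConvexOn m G →
  ∀ {k b i a T} → b < i → i < a → a ≤ k → a ≤ n → k ∸ b ≤ m →
  F b +ℚ G (k ∸ b) ≤ℚ T → F a +ℚ G (k ∸ a) ≤ℚ T → F i +ℚ G (k ∸ i) ≤ℚ T
diagonal-sublevel-convex convexF convexG {k} {b} {i} {a} b<i i<a a≤k a≤n k∸b≤m =
  weighted-sum-≤ (ℕ→ℚ (a ∸ b)) (ℕ→ℚ (a ∸ i)) (ℕ→ℚ (i ∸ b))
    {{ℕ→ℚ-pos (m<n⇒0<n∸m (≤-trans b<i (<⇒≤ i<a)))}}
    {{ℕ→ℚ-nonNeg (a ∸ i)}} {{ℕ→ℚ-nonNeg (i ∸ b)}}
    (trans (cong ℕ→ℚ (∸-split (<⇒≤ b<i) (<⇒≤ i<a))) (ℕ→ℚ-+ (a ∸ i) (i ∸ b)))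
    (convexF b i a b<i i<a a≤n)
    (ConvexOn-reflect convexG b<i i<a a≤k k∸b≤m)

lemma4p3 : (n m : ℕ) (f g : ℕ → ℤ) (F G H : ℕ → ℚ) →
    IsConvexEnvelope n f F → IsConvexEnvelope m g G → IsMinConvolution n m F G H →
    (δ : ℚ) → 0ℚ ≤ℚ δ →
    ∀ i j → i ≤ n → j ≤ m → (a b : ℕ) →
    IsPplus n m F G H δ (i + j) a → IsPminus n m F G H δ (i + j) b →
    Relevant n m F G H δ i j ⇔ (b ≤ i × i ≤ a)
lemma4p3 n m f g F G H (convexF , _) (convexG , _) _ δ _ i j i≤n j≤m a b
  (a≤k , relevant-a , maximal-a) (b≤k , relevant-b , minimal-b) =
  mk⇔ (λ r → minimal-b i i≤k (on-diagonal r) , maximal-a i i≤k (on-diagonal r)) between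
  where
  k = i + j
  R = Relevant n m F G H δ
  i≤k : i ≤ k
  i≤k = m≤m+n i j
  on-diagonal : R i j → R i (k ∸ i)
  on-diagonal = subst (R i) (≡-sym (m+n∸m≡n i j))
  off-diagonal : ∀ {x} → x ≡ i → R x (k ∸ x) → R i j
  off-diagonal refl = subst (R i) (m+n∸m≡n i j)
  value-bound : ∀ {x} → x ≤ k → R x (k ∸ x) → F x +ℚ G (k ∸ x) ≤ℚ H k +ℚ δ
  value-bound {x} x≤k (_ , _ , bound) =
    subst (λ t → F x +ℚ G (k ∸ x) ≤ℚ H t +ℚ δ) (m+[n∸m]≡n x≤k) bound
  between : b ≤ i × i ≤ a → R i j
  between (b≤i , i≤a) with m≤n⇒m<n∨m≡n b≤i | m≤n⇒m<n∨m≡n i≤a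
  ... | inj₂ b≡i | _        = off-diagonal b≡i relevant-b
  ... | inj₁ _   | inj₂ i≡a = off-diagonal (≡-sym i≡a) relevant-a
  ... | inj₁ b<i | inj₁ i<a =
    i≤n , j≤m ,
    subst (λ t → F i +ℚ G t ≤ℚ H k +ℚ δ) (m+n∸m≡n i j)
      (diagonal-sublevel-convex convexF convexG b<i i<a a≤k
        (proj₁ relevant-a) (proj₁ (proj₂ relevant-b))
        (value-bound b≤k relevant-b) (value-bound a≤k relevant-a))
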